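{- There exist two infinite binary words $\mathbf x$ and $\mathbf y$ such that neither $\mathbf x$ nor $\mathbf y$ contains a square $ww$ with $|w|\ge 4$, but their perfect shuffle $\mathbf x \,\mathrm{SH}\, \mathbf y$ contains arbitrarily large squares.
   Context: For words $\mathbf x=a_1a_2a_3\cdots$ and $\mathbf y=b_1b_2b_3\cdots$, the perfect shuffle is $\mathbf x\,\mathrm{SH}\,\mathbf y=a_1b_1a_2b_2a_3b_3\cdots$. A square is a nonempty word $ww$ occurring as a contiguous subword. -}

module Defs where

open import Data.Nat using (ℕ; zero; suc; _+_; _*_; _≤_; _<_)
open import Data.Bool using (Bool)
open import Data.Product using (Σ; _×_; ∃-syntax)
open import Relation.Binary.PropositionalEquality using (_≡_)

Word : Set
Word = ℕ → Bool

-- Perfect shuffle: (x SH y)_{2k} = x_k, (x SH y)_{2k+1} = y_k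
SH : Word → Word → Word
SH x y zero = x zero
SH x y (suc zero) = y zero
SH x y (suc (suc n)) = SH (λ k → x (suc k)) (λ k → y (suc k)) n

SquareAt : Word → ℕ → ℕ → Set
SquareAt x i n = (0 < n) × (∀ k → k < n → x (i + k) ≡ x (i + n + k))

HasSquareOfLength : Word → ℕ → Set
HasSquareOfLength x n = ∃[ i ] SquareAt x i n

HasSquareAtLeast : Word → ℕ → Set
HasSquareAtLeast x m = ∃[ n ] (m ≤ n × HasSquareOfLength x n)

ArbitrarilyLargeSquares : Word → Set
ArbitrarilyLargeSquares x = ∀ m → HasSquareAtLeast x m

module Submission where

-- Let z be the fixed point of 0 ↦ 001, 1 ↦ 110, and let x and y be its subsequences at even
-- and odd positions, so that SH x y = z.  The prefix of z of length 3^m is immediately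
-- repeated, which gives the large squares.  The pair word p = (x, y) is the fixed point of
-- ψ(a, b) = (a, a)(¬a, b)(b, ¬b).  Hence the length-6 window of p at 3q + r is computed from
-- the window at q, so all windows lie in a finite set F₆ closed under this computation, and
-- the window at q determines the 18 letters of x and of y from position 3q on.
-- Inspecting F₆ shows that x and y have no square of length 3 to 8, and that a factor of
-- length 9 determines its starting position modulo 3.  A longer square therefore has length
-- 3m, and since x(3j) = x(j) and y(3j + 1) = y(j) it yields a square of length m.

open import Data.Bool using (Bool; false; not)
import Data.Bool.Properties as Bool
open import Data.List using (List; []; _∷_; _++_; map; concatMap; take; drop; upTo)
import Data.List.Properties as List
open import Data.List.Membership.Propositional using (_∈_)
open import Data.List.Relation.Unary.All using (All; all?)
import Data.List.Relation.Unary.All as All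
open import Data.List.Relation.Unary.Any using (here)
open import Data.Nat using (ℕ; zero; suc; _+_; _*_; _∸_; _^_; _≤_; _<_; z≤n; s≤s; z<s; s<s; NonZero; >-nonZero)
open import Data.Nat.DivMod
open import Data.Nat.Divisibility using (_∣_; divides; divides-refl; ∣m+n∣m⇒∣n; n∣m*n)
open import Data.Nat.Induction using (<-rec)
open import Data.Nat.Properties
open import Data.Nat.Tactic.RingSolver using (solve-∀; solve)
open import Data.Product using (_×_; _,_; proj₁; proj₂; ∃-syntax)
import Data.Product.Properties as Product
open import Function using (id; _∘_)
open import Relation.Binary.Definitions using (DecidableEquality)
open import Relation.Binary.PropositionalEquality
open import Relation.Nullary.Decidable using (Dec; yes; no; from-yes; decidable-stable; ¬?; _→-dec_)
open import Relation.Nullary.Negation using (¬_)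
open ≡-Reasoning

open import Defs

[m+kn]%n≡m : ∀ {m n} k .{{_ : NonZero n}} → m < n → (m + k * n) % n ≡ m
[m+kn]%n≡m {m} {n} k m<n = trans ([m+kn]%n≡m%n m k n) (m<n⇒m%n≡m m<n)

[m+kn]/n≡k : ∀ {m n} k .{{_ : NonZero n}} → m < n → (m + k * n) / n ≡ k
[m+kn]/n≡k {m} {n} k m<n = begin
  (m + k * n) / n    ≡⟨ +-distrib-/-∣ʳ m (divides-refl k) ⟩
  m / n + k * n / n  ≡⟨ cong₂ _+_ (m<n⇒m/n≡0 m<n) (m*n/n≡m k n) ⟩
  k                  ∎

m≡[m/n]*n+m%n : ∀ m n .{{_ : NonZero n}} → m ≡ m / n * n + m % n
m≡[m/n]*n+m%n m n = trans (m≡m%n+[m/n]*n m n) (+-comm (m % n) (m / n * n))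

n≤1+f⇒n/3≤f : ∀ {n f} → n ≤ suc f → n / 3 ≤ f
n≤1+f⇒n/3≤f {zero}  _     = z≤n
n≤1+f⇒n/3≤f {suc n} n≤1+f = ≤-pred (≤-trans (m/n<m (suc n) 3 (s<s z<s)) n≤1+f)

n<m^n : ∀ {m} n → 1 < m → n < m ^ n
n<m^n {suc _}     zero    _   = z<s
n<m^n {m@(suc _)} (suc n) 1<m =
  ≤-<-trans (n<m^n n 1<m) (subst (m ^ n <_) (*-comm (m ^ n) m) (m<m*n (m ^ n) m {{m^n≢0 m n}} 1<m))

SquareAt-resp-≗ : ∀ {w w′ : Word} {i n} → w ≗ w′ → SquareAt w i n → SquareAt w′ i n
SquareAt-resp-≗ {i = i} {n} w≗w′ (0<n , sq) =
  0<n , λ k k<n → trans (sym (w≗w′ (i + k))) (trans (sq k k<n) (w≗w′ (i + n + k)))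

factor : {A : Set} → (ℕ → A) → ℕ → ℕ → List A
factor w i zero    = []
factor w i (suc n) = w i ∷ factor w (suc i) n

factor-++ : ∀ {A : Set} (w : ℕ → A) i m n → factor w i (m + n) ≡ factor w i m ++ factor w (i + m) n
factor-++ w i zero    n = cong (λ j → factor w j n) (sym (+-identityʳ i))
factor-++ w i (suc m) n = cong (w i ∷_) (begin
  factor w (suc i) (m + n)                           ≡⟨ factor-++ w (suc i) m n ⟩
  factor w (suc i) m ++ factor w (suc i + m) n       ≡⟨ cong (λ j → factor w (suc i) m ++ factor w j n) (+-suc i m) ⟨
  factor w (suc i) m ++ factor w (i + suc m) n       ∎)

map-factor : ∀ {A B : Set} (f : A → B) (w : ℕ → A) i n → map f (factor w i n) ≡ factor (f ∘ w) i n
map-factor f w i zero    = refl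
map-factor f w i (suc n) = cong (f (w i) ∷_) (map-factor f w (suc i) n)

factor-cong : ∀ {A : Set} (w w′ : ℕ → A) i j n → (∀ k → k < n → w (i + k) ≡ w′ (j + k)) → factor w i n ≡ factor w′ j n
factor-cong w w′ i j zero    _ = refl
factor-cong w w′ i j (suc n) h = cong₂ _∷_ (head-agrees) (factor-cong w w′ (suc i) (suc j) n tail-agrees)
  where
  head-agrees : w i ≡ w′ j
  head-agrees = subst₂ (λ a b → w a ≡ w′ b) (+-identityʳ i) (+-identityʳ j) (h 0 z<s)
  tail-agrees : ∀ k → k < n → w (suc i + k) ≡ w′ (suc j + k)
  tail-agrees k k<n = subst₂ (λ a b → w a ≡ w′ b) (+-suc i k) (+-suc j k) (h (suc k) (s<s k<n))

take-factor : ∀ {A : Set} (w : ℕ → A) i {m n} → m ≤ n → take m (factor w i n) ≡ factor w i m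
take-factor w i z≤n       = refl
take-factor w i (s≤s m≤n) = cong (w i ∷_) (take-factor w (suc i) m≤n)

drop-factor : ∀ {A : Set} (w : ℕ → A) i a n → drop a (factor w i n) ≡ factor w (i + a) (n ∸ a)
drop-factor w i zero    n       = cong (λ j → factor w j n) (sym (+-identityʳ i))
drop-factor w i (suc a) zero    = refl
drop-factor w i (suc a) (suc n) = trans (drop-factor w (suc i) a n) (cong (λ j → factor w j (n ∸ a)) (sym (+-suc i a)))

SH-interleave : ∀ {x y w : Word} → (∀ k → x k ≡ w (2 * k)) → (∀ k → y k ≡ w (suc (2 * k))) → SH x y ≗ w
SH-interleave x≡ y≡ zero          = x≡ 0
SH-interleave x≡ y≡ (suc zero)    = y≡ 0
SH-interleave {w = w} x≡ y≡ (suc (suc n)) =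
  SH-interleave {w = w ∘ suc ∘ suc}
    (λ k → trans (x≡ (suc k)) (cong w (*-suc 2 k)))
    (λ k → trans (y≡ (suc k)) (cong (w ∘ suc) (*-suc 2 k)))
    n

-- Square-freeness of self-similar words

module SelfSimilar (w : Word) {c : ℕ} (c<3 : c < 3) (w-sub : ∀ j → w (c + j * 3) ≡ w j) where

  reach-residue : ∀ i → ∃[ t ] ∃[ j ] (t < 3 × i + t ≡ c + j * 3)
  reach-residue zero = c , 0 , c<3 , sym (+-identityʳ c)
  reach-residue (suc i) with reach-residue i
  ... | suc t , j , t<3 , e = t , j , <-trans (n<1+n t) t<3 , trans (sym (+-suc i t)) e
  ... | zero  , j , _   , e = 2 , suc j , s<s (s<s z<s) , (begin
    suc i + 2        ≡⟨ cong suc (+-comm i 2) ⟩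
    3 + i            ≡⟨ cong (3 +_) (trans (sym (+-identityʳ i)) e) ⟩
    3 + (c + j * 3)  ≡⟨ solve (c ∷ j ∷ []) ⟩
    c + suc j * 3    ∎)

  square-descent : ∀ {m} → HasSquareOfLength w (m * 3) → HasSquareOfLength w m
  square-descent {m@(suc _)} (i , _ , sq) with reach-residue i
  ... | t , j , t<3 , e = j , z<s , λ k k<m → begin
    w (j + k)                    ≡⟨ w-sub (j + k) ⟨
    w (c + (j + k) * 3)          ≡⟨ cong w (shift k) ⟨
    w (i + (t + k * 3))          ≡⟨ sq (t + k * 3) (<-≤-trans (+-monoˡ-< (k * 3) t<3) (*-monoˡ-≤ 3 k<m)) ⟩
    w (i + m * 3 + (t + k * 3))  ≡⟨ cong w (trans (regroup i m t k) (shift (m + k))) ⟩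
    w (c + (j + (m + k)) * 3)    ≡⟨ cong (λ a → w (c + a * 3)) (+-assoc j m k) ⟨
    w (c + (j + m + k) * 3)      ≡⟨ w-sub (j + m + k) ⟩
    w (j + m + k)                ∎
    where
    shift : ∀ a → i + (t + a * 3) ≡ c + (j + a) * 3
    shift a = begin
      i + (t + a * 3)      ≡⟨ +-assoc i t (a * 3) ⟨
      i + t + a * 3        ≡⟨ cong (_+ a * 3) e ⟩
      c + j * 3 + a * 3    ≡⟨ +-assoc c (j * 3) (a * 3) ⟩
      c + (j * 3 + a * 3)  ≡⟨ cong (c +_) (*-distribʳ-+ 3 j a) ⟨
      c + (j + a) * 3      ∎
    regroup : ∀ i m t k → i + m * 3 + (t + k * 3) ≡ i + (t + (m + k) * 3)
    regroup = solve-∀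

  no-square≥3 : (∀ {n} → 3 ≤ n → n < 9 → ¬ HasSquareOfLength w n) →
                (∀ {n} → 9 ≤ n → HasSquareOfLength w n → 3 ∣ n) →
                ∀ n → 3 ≤ n → ¬ HasSquareOfLength w n
  no-square≥3 no-short 3∣long = <-rec (λ n → 3 ≤ n → ¬ HasSquareOfLength w n) step
    where
    step : ∀ n → (∀ {m} → m < n → 3 ≤ m → ¬ HasSquareOfLength w m) → 3 ≤ n → ¬ HasSquareOfLength w n
    step n ih 3≤n sq with n <? 9
    ... | yes n<9 = no-short 3≤n n<9 sq
    ... | no  n≮9 with 3∣long (≮⇒≥ n≮9) sq
    ... | divides m refl = ih m<m*3 3≤m (square-descent sq)
      where
      3≤m : 3 ≤ m
      3≤m = *-cancelʳ-≤ 3 m 3 (≮⇒≥ n≮9)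
      m<m*3 : m < m * 3
      m<m*3 = m<m*n m 3 {{>-nonZero (<-≤-trans z<s 3≤m)}} (s<s z<s)

-- The ternary word z and its subsequences x and y

digitStep : ℕ → Bool → Bool
digitStep 2 = not
digitStep _ = id

-- z n is the parity of the number of digits 2 in the ternary expansion of n;
-- the first argument of z-fuel bounds the recursion depth.
z-fuel : ℕ → ℕ → Bool
z-fuel zero    _       = false
z-fuel (suc f) zero    = false
z-fuel (suc f) (suc n) = digitStep (suc n % 3) (z-fuel f (suc n / 3))

z : Word
z n = z-fuel n n

z-fuel-irrelevant : ∀ f g {n} → n ≤ f → n ≤ g → z-fuel f n ≡ z-fuel g n
z-fuel-irrelevant zero    zero    _   _   = refl
z-fuel-irrelevant zero    (suc g) z≤n _   = refl
z-fuel-irrelevant (suc f) zero    _   z≤n = refl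
z-fuel-irrelevant (suc f) (suc g) {zero}  _ _ = refl
z-fuel-irrelevant (suc f) (suc g) {suc n} n≤1+f n≤1+g =
  cong (digitStep (suc n % 3)) (z-fuel-irrelevant f g (n≤1+f⇒n/3≤f n≤1+f) (n≤1+f⇒n/3≤f n≤1+g))

z-unfold : ∀ n → z n ≡ digitStep (n % 3) (z (n / 3))
z-unfold zero    = refl
z-unfold (suc n) = cong (digitStep (suc n % 3)) (z-fuel-irrelevant n _ (n≤1+f⇒n/3≤f ≤-refl) ≤-refl)

z-ternary : ∀ n r j → n ≡ r + j * 3 → r < 3 → z n ≡ digitStep r (z j)
z-ternary _ r j refl r<3 = begin
  z (r + j * 3)                                     ≡⟨ z-unfold (r + j * 3) ⟩
  digitStep ((r + j * 3) % 3) (z ((r + j * 3) / 3)) ≡⟨ cong₂ (λ a b → digitStep a (z b)) ([m+kn]%n≡m j r<3) ([m+kn]/n≡k j r<3) ⟩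
  digitStep r (z j)                                 ∎

z-repeats : ∀ m k → k < 3 ^ m → z (3 ^ m + k) ≡ z k
z-repeats zero    zero    _        = refl
z-repeats zero    (suc _) (s<s ())
z-repeats (suc m) k       k<3^1+m = begin
  z (3 ^ suc m + k)              ≡⟨ z-ternary _ r (3 ^ m + j) shift r<3 ⟩
  digitStep r (z (3 ^ m + j))    ≡⟨ cong (digitStep r) (z-repeats m j j<3^m) ⟩
  digitStep r (z j)              ≡⟨ z-ternary k r j (m≡m%n+[m/n]*n k 3) r<3 ⟨
  z k                            ∎
  where
  r = k % 3
  j = k / 3
  r<3 = m%n<n k 3
  j<3^m : j < 3 ^ m
  j<3^m = m<n*o⇒m/o<n (subst (k <_) (*-comm 3 (3 ^ m)) k<3^1+m)
  shift : 3 ^ suc m + k ≡ r + (3 ^ m + j) * 3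
  shift = begin
    3 * 3 ^ m + k            ≡⟨ cong (3 * 3 ^ m +_) (m≡m%n+[m/n]*n k 3) ⟩
    3 * 3 ^ m + (r + j * 3)  ≡⟨ rearrange (3 ^ m) r j ⟩
    r + (3 ^ m + j) * 3      ∎
    where
    rearrange : ∀ a r j → 3 * a + (r + j * 3) ≡ r + (a + j) * 3
    rearrange = solve-∀

z-square : ∀ m → SquareAt z 0 (3 ^ m)
z-square m = m^n>0 3 m , λ k k<3^m → sym (z-repeats m k k<3^m)

x y : Word
x n = z (2 * n)
y n = z (suc (2 * n))

z≗SH-x-y : z ≗ SH x y
z≗SH-x-y n = sym (SH-interleave {w = z} (λ _ → refl) (λ _ → refl) n)

x[3q]≡x[q] : ∀ q → x (q * 3) ≡ x q
x[3q]≡x[q] q = z-ternary (2 * (q * 3)) 0 (2 * q) (solve (q ∷ [])) z<s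

x[3q+1]≡¬x[q] : ∀ q → x (1 + q * 3) ≡ not (x q)
x[3q+1]≡¬x[q] q = z-ternary (2 * (1 + q * 3)) 2 (2 * q) (solve (q ∷ [])) (s<s (s<s z<s))

x[3q+2]≡y[q] : ∀ q → x (2 + q * 3) ≡ y q
x[3q+2]≡y[q] q = z-ternary (2 * (2 + q * 3)) 1 (1 + 2 * q) (solve (q ∷ [])) (s<s z<s)

y[3q]≡x[q] : ∀ q → y (q * 3) ≡ x q
y[3q]≡x[q] q = z-ternary (1 + 2 * (q * 3)) 1 (2 * q) (solve (q ∷ [])) (s<s z<s)

y[3q+1]≡y[q] : ∀ q → y (1 + q * 3) ≡ y q
y[3q+1]≡y[q] q = z-ternary (1 + 2 * (1 + q * 3)) 0 (1 + 2 * q) (solve (q ∷ [])) z<s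

y[3q+2]≡¬y[q] : ∀ q → y (2 + q * 3) ≡ not (y q)
y[3q+2]≡¬y[q] q = z-ternary (1 + 2 * (2 + q * 3)) 2 (1 + 2 * q) (solve (q ∷ [])) (s<s (s<s z<s))

SH-x-y-large-squares : ArbitrarilyLargeSquares (SH x y)
SH-x-y-large-squares m = 3 ^ m , <⇒≤ (n<m^n m (s<s z<s)) , 0 , SquareAt-resp-≗ {i = 0} z≗SH-x-y (z-square m)

-- The pair word p = (x, y) as a fixed point of ψ

Pair : Set
Pair = Bool × Bool

p : ℕ → Pair
p n = x n , y n

ψ : Pair → List Pair
ψ (a , b) = (a , a) ∷ (not a , b) ∷ (b , not b) ∷ []

ψ* : List Pair → List Pair
ψ* = concatMap ψ

factor-p-3 : ∀ q → factor p (q * 3) 3 ≡ ψ (p q)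
factor-p-3 q =
  cong₂ _∷_ (cong₂ _,_ (x[3q]≡x[q] q) (y[3q]≡x[q] q))
  (cong₂ _∷_ (cong₂ _,_ (x[3q+1]≡¬x[q] q) (y[3q+1]≡y[q] q))
  (cong₂ _∷_ (cong₂ _,_ (x[3q+2]≡y[q] q) (y[3q+2]≡¬y[q] q)) refl))

factor-p-ψ* : ∀ n q → factor p (q * 3) (n * 3) ≡ ψ* (factor p q n)
factor-p-ψ* zero    q = refl
factor-p-ψ* (suc n) q = begin
  factor p (q * 3) (3 + n * 3)                        ≡⟨ factor-++ p (q * 3) 3 (n * 3) ⟩
  factor p (q * 3) 3 ++ factor p (q * 3 + 3) (n * 3)  ≡⟨ cong₂ _++_ (factor-p-3 q) (cong (λ i → factor p i (n * 3)) (+-comm (q * 3) 3)) ⟩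
  ψ (p q) ++ factor p (suc q * 3) (n * 3)             ≡⟨ cong (ψ (p q) ++_) (factor-p-ψ* n (suc q)) ⟩
  ψ (p q) ++ ψ* (factor p (suc q) n)                  ∎

next : ℕ → List Pair → List Pair
next r v = take 6 (drop r (ψ* (take 3 v)))

factor-p-next : ∀ r q → r < 3 → factor p (r + q * 3) 6 ≡ next r (factor p q 6)
factor-p-next r q r<3 = trans (window r r<3) (cong (take 6 ∘ drop r) (factor-p-ψ* 3 q))
  where
  window : ∀ r → r < 3 → factor p (r + q * 3) 6 ≡ take 6 (drop r (factor p (q * 3) 9))
  window 0 _ = refl
  window 1 _ = refl
  window 2 _ = refl
  window (suc (suc (suc _))) (s<s (s<s (s<s ())))

-- The set F₆ of windows and the finite checks

_≟ᵥ_ : DecidableEquality (List Pair)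
_≟ᵥ_ = List.≡-dec (Product.≡-dec Bool._≟_ Bool._≟_)

open import Data.List.Membership.DecPropositional _≟ᵥ_ using (_∈?_)

-- The positions of the first occurrences of the 44 distinct windows of p.
F₆ : List (List Pair)
F₆ = map (λ q → factor p q 6) (upTo 36 ++ 40 ∷ 49 ∷ 62 ∷ 67 ∷ 71 ∷ 76 ∷ 89 ∷ 107 ∷ [])

F₆-closed : All (λ v → ∀ {r} → r < 3 → next r v ∈ F₆) F₆
F₆-closed = from-yes (all? (λ v → allUpTo? (λ r → next r v ∈? F₆) 3) F₆)

factor-p∈F₆ : ∀ q → factor p q 6 ∈ F₆
factor-p∈F₆ = <-rec (λ q → factor p q 6 ∈ F₆) step
  where
  step : ∀ q → (∀ {j} → j < q → factor p j 6 ∈ F₆) → factor p q 6 ∈ F₆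
  step zero      _  = here refl
  step q@(suc _) ih = subst (_∈ F₆) (cong (λ i → factor p i 6) (sym (m≡m%n+[m/n]*n q 3)))
    (subst (_∈ F₆) (sym (factor-p-next (q % 3) (q / 3) (m%n<n q 3)))
      (All.lookup F₆-closed (ih (m/n<m q 3 (s<s z<s))) (m%n<n q 3)))

segment : (Pair → Bool) → List Pair → ℕ → ℕ → List Bool
segment π v a m = take m (drop a (map π (ψ* v)))

factor-segment : ∀ π q a m → a + m ≤ 18 → factor (π ∘ p) (q * 3 + a) m ≡ segment π (factor p q 6) a m
factor-segment π q a m a+m≤18 = begin
  factor (π ∘ p) (q * 3 + a) m                        ≡⟨ take-factor (π ∘ p) (q * 3 + a) m≤18∸a ⟨
  take m (factor (π ∘ p) (q * 3 + a) (18 ∸ a))        ≡⟨ cong (take m) (drop-factor (π ∘ p) (q * 3) a 18) ⟨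
  take m (drop a (factor (π ∘ p) (q * 3) 18))         ≡⟨ cong (take m ∘ drop a) (map-factor π p (q * 3) 18) ⟨
  take m (drop a (map π (factor p (q * 3) 18)))       ≡⟨ cong (take m ∘ drop a ∘ map π) (factor-p-ψ* 6 q) ⟩
  segment π (factor p q 6) a m                        ∎
  where
  m≤18∸a : m ≤ 18 ∸ a
  m≤18∸a = m+n≤o⇒m≤o∸n m (subst (_≤ 18) (+-comm a m) a+m≤18)

ShortSquareFree : (Pair → Bool) → List Pair → Set
ShortSquareFree π v = ∀ {r} → r < 3 → ∀ {n} → n < 6 →
  segment π v r (3 + n) ≢ segment π v (r + (3 + n)) (3 + n)

Desynchronised : (Pair → Bool) → List Pair → List Pair → Set
Desynchronised π v v′ = ∀ {r} → r < 3 → ∀ {r′} → r′ < 3 → r ≢ r′ → segment π v r 9 ≢ segment π v′ r′ 9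

_≟ᵇ_ : DecidableEquality (List Bool)
_≟ᵇ_ = List.≡-dec Bool._≟_

shortSquareFree? : ∀ π v → Dec (ShortSquareFree π v)
shortSquareFree? π v = allUpTo? (λ r → allUpTo? (λ n →
  ¬? (segment π v r (3 + n) ≟ᵇ segment π v (r + (3 + n)) (3 + n))) 6) 3

desynchronised? : ∀ π v v′ → Dec (Desynchronised π v v′)
desynchronised? π v v′ = allUpTo? (λ r → allUpTo? (λ r′ →
  ¬? (r ≟ r′) →-dec ¬? (segment π v r 9 ≟ᵇ segment π v′ r′ 9)) 3) 3

module Windows (π : Pair → Bool)
  (short-square-free : All (ShortSquareFree π) F₆)
  (desynchronised : All (λ v → All (Desynchronised π v) F₆) F₆) where

  w : Word
  w = π ∘ p

  no-short-square-at : ∀ q r n → r < 3 → n < 6 → factor w (q * 3 + r) (3 + n) ≢ factor w (q * 3 + r + (3 + n)) (3 + n)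
  no-short-square-at q r n r<3 n<6 eq =
    All.lookup short-square-free (factor-p∈F₆ q) r<3 n<6 (begin
      segment π (factor p q 6) r (3 + n)             ≡⟨ factor-segment π q r (3 + n) (m+n≤o⇒m≤o (r + (3 + n)) fits) ⟨
      factor w (q * 3 + r) (3 + n)                   ≡⟨ eq ⟩
      factor w (q * 3 + r + (3 + n)) (3 + n)         ≡⟨ cong (λ i → factor w i (3 + n)) (+-assoc (q * 3) r (3 + n)) ⟩
      factor w (q * 3 + (r + (3 + n))) (3 + n)       ≡⟨ factor-segment π q (r + (3 + n)) (3 + n) fits ⟩
      segment π (factor p q 6) (r + (3 + n)) (3 + n) ∎)
    where
    fits : r + (3 + n) + (3 + n) ≤ 18
    fits = +-mono-≤ (+-mono-≤ (≤-pred r<3) (+-monoʳ-≤ 3 (≤-pred n<6))) (+-monoʳ-≤ 3 (≤-pred n<6))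

  residues-agree : ∀ q r q′ r′ → r < 3 → r′ < 3 → factor w (q * 3 + r) 9 ≡ factor w (q′ * 3 + r′) 9 → r ≡ r′
  residues-agree q r q′ r′ r<3 r′<3 eq = decidable-stable (r ≟ r′) λ r≢r′ →
    All.lookup (All.lookup desynchronised (factor-p∈F₆ q)) (factor-p∈F₆ q′) r<3 r′<3 r≢r′
      (trans (sym (factor-segment π q r 9 (fits r<3))) (trans eq (factor-segment π q′ r′ 9 (fits r′<3))))
    where
    fits : ∀ {r} → r < 3 → r + 9 ≤ 18
    fits r<3 = +-monoˡ-≤ 9 (≤-trans (≤-pred r<3) (m≤m+n 2 7))

  no-short-square : ∀ {n} → 3 ≤ n → n < 9 → ¬ HasSquareOfLength w n
  no-short-square {suc (suc (suc n))} (s≤s (s≤s (s≤s z≤n))) (s<s (s<s (s<s n<6))) (i , _ , sq) =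
    no-short-square-at q r n (m%n<n i 3) n<6 (begin
      factor w (q * 3 + r) (3 + n)            ≡⟨ cong (λ j → factor w j (3 + n)) i≡ ⟨
      factor w i (3 + n)                      ≡⟨ factor-cong w w i (i + (3 + n)) (3 + n) sq ⟩
      factor w (i + (3 + n)) (3 + n)          ≡⟨ cong (λ j → factor w (j + (3 + n)) (3 + n)) i≡ ⟩
      factor w (q * 3 + r + (3 + n)) (3 + n)  ∎)
    where
    q = i / 3
    r = i % 3
    i≡ = m≡[m/n]*n+m%n i 3

  3∣long-square : ∀ {n} → 9 ≤ n → HasSquareOfLength w n → 3 ∣ n
  3∣long-square {n} 9≤n (i , _ , sq) = ∣m+n∣m⇒∣n (divides q′ q*3+n≡q′*3) (n∣m*n q)
    where
    q = i / 3
    q′ = (i + n) / 3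
    r≡r′ : i % 3 ≡ (i + n) % 3
    r≡r′ = residues-agree q (i % 3) q′ ((i + n) % 3) (m%n<n i 3) (m%n<n (i + n) 3) (begin
      factor w (q * 3 + i % 3) 9           ≡⟨ cong (λ j → factor w j 9) (m≡[m/n]*n+m%n i 3) ⟨
      factor w i 9                         ≡⟨ factor-cong w w i (i + n) 9 (λ k k<9 → sq k (<-≤-trans k<9 9≤n)) ⟩
      factor w (i + n) 9                   ≡⟨ cong (λ j → factor w j 9) (m≡[m/n]*n+m%n (i + n) 3) ⟩
      factor w (q′ * 3 + (i + n) % 3) 9    ∎)
    q*3+n≡q′*3 : q * 3 + n ≡ q′ * 3
    q*3+n≡q′*3 = +-cancelʳ-≡ (i % 3) _ _ (begin
      q * 3 + n + i % 3     ≡⟨ +-assoc (q * 3) n (i % 3) ⟩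
      q * 3 + (n + i % 3)   ≡⟨ cong (q * 3 +_) (+-comm n (i % 3)) ⟩
      q * 3 + (i % 3 + n)   ≡⟨ +-assoc (q * 3) (i % 3) n ⟨
      q * 3 + i % 3 + n     ≡⟨ cong (_+ n) (m≡[m/n]*n+m%n i 3) ⟨
      i + n                 ≡⟨ m≡[m/n]*n+m%n (i + n) 3 ⟩
      q′ * 3 + (i + n) % 3  ≡⟨ cong (q′ * 3 +_) r≡r′ ⟨
      q′ * 3 + i % 3        ∎)

  no-square≥4 : ∀ {c} → c < 3 → (∀ j → w (c + j * 3) ≡ w j) → ¬ HasSquareAtLeast w 4
  no-square≥4 c<3 w-sub (n , 4≤n , sq) =
    SelfSimilar.no-square≥3 w c<3 w-sub no-short-square 3∣long-square n (<⇒≤ 4≤n) sq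

module X = Windows proj₁ (from-yes (all? (shortSquareFree? proj₁) F₆))
                         (from-yes (all? (λ v → all? (desynchronised? proj₁ v) F₆) F₆))
module Y = Windows proj₂ (from-yes (all? (shortSquareFree? proj₂) F₆))
                         (from-yes (all? (λ v → all? (desynchronised? proj₂ v) F₆) F₆))

theorem13 : ∃[ x ] ∃[ y ] (¬ HasSquareAtLeast x 4 × ¬ HasSquareAtLeast y 4 × ArbitrarilyLargeSquares (SH x y))
theorem13 =
  x , y , X.no-square≥4 z<s x[3q]≡x[q] , Y.no-square≥4 (s<s z<s) y[3q+1]≡y[q] , SH-x-y-large-squares
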